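{- Consider an instance of Multistage Knapsack with $T$ time steps and its linear relaxation (LP-MK). Let $\hat S=(\hat x,\hat z)$ be a basic solution of (LP-MK) with $\hat z_{ti}=1-|\hat x_{(t+1)i}-\hat x_{ti}|$ for all $t\le T-1$, $i\in N$, and let $1\le t_0\le t_1\le T$. Let $F(t_0,t_1)$ be the set of objects $i$ such that $0<\hat x_{t_0i}=\hat x_{(t_0+1)i}=\dots=\hat x_{t_1i}<1$, either $t_0=1$ or $\hat x_{(t_0-1)i}\ne\hat x_{t_0i}$, and either $t_1=T$ or $\hat x_{(t_1+1)i}\ne \hat x_{t_1i}$. Then $|F(t_0,t_1)|\le t_1+1-t_0$.
   Context: Multistage Knapsack: given a time horizon $T\ge 1$, objects $N=\{1,\dots,n\}$, for each $t\in\{1,\dots,T\}$ and $i\in N$ a profit $p_{ti}$ and a weight $w_{ti}$, for each $t\in\{1,\dots,T-1\}$ and $i\in N$ a bonus $B_{ti}\ge 0$, and capacities $C_t$. (LP-MK) is the linear program with variables $x_{ti}\in[0,1]$ ($t=1,\dots,T$, $i\in N$) and $z_{ti}\in[0,1]$ ($t=1,\dots,T-1$, $i\in N$): maximize $\sum_{t=1}^T\sum_{i\in N}p_{ti}x_{ti}+\sum_{t=1}^{T-1}\sum_{i\in N}B_{ti}z_{ti}$ subject to $\sum_{i\in N}w_{ti}x_{ti}\le C_t$ for all $t$, $z_{ti}\le -x_{(t+1)i}+x_{ti}+1$ and $z_{ti}\le x_{(t+1)i}-x_{ti}+1$ for all $t\le T-1$, $i\in N$. A basic solution is a vertex (extreme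 point) of the feasible polyhedron.
   Formalization: The instance data $p_{ti}$, $w_{ti}$, $B_{ti}$, $C_t$ are rational, and the points of (LP-MK), including those tested in the definition of a basic solution, have rational coordinates rather than real ones. -}

module Defs where

open import Data.Nat as ℕ using (ℕ; zero; suc; _∸_; _≤_; _<_)
open import Data.Fin using (Fin; toℕ)
open import Data.Fin.Properties using (all?)
open import Data.Rational as Q using (ℚ; 0ℚ; 1ℚ; _+_; _*_; _-_; ∣_∣)
open import Data.Rational.Properties using (_≟_; _<?_)
open import Data.Product using (_×_; _,_)
open import Data.Sum using (_⊎_)
open import Data.List using (length; filter; allFin)
open import Relation.Nullary using (¬_; Dec; _×-dec_; _⊎-dec_; ¬?)
open import Relation.Binary.PropositionalEquality using (_≡_; _≢_)

∑ : {n : ℕ} → (Fin n → ℚ) → ℚ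
∑ {zero}  f = 0ℚ
∑ {suc n} f = f Fin.zero + ∑ (λ i → f (Fin.suc i))

-- An instance of Multistage Knapsack (rational data).  Time steps are the
-- natural numbers 1..T; values of the data outside this range are irrelevant.
record Instance : Set where
  field
    T   : ℕ
    T≥1 : 1 ≤ T
    n   : ℕ
    p   : ℕ → Fin n → ℚ
    w   : ℕ → Fin n → ℚ
    B   : ℕ → Fin n → ℚ
    B≥0 : ∀ t i → 1 ≤ t → t < T → 0ℚ Q.≤ B t i
    C   : ℕ → ℚ

-- A candidate point (x, z) of (LP-MK): only the coordinates x t i with
-- 1 ≤ t ≤ T and z t i with 1 ≤ t ≤ T-1 are meaningful.
record Point (n : ℕ) : Set where
  constructor ⟨_,_⟩
  field
    x : ℕ → Fin n → ℚ
    z : ℕ → Fin n → ℚ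

module _ (I : Instance) where
  open Instance I

  Feasible : Point n → Set
  Feasible ⟨ x , z ⟩ =
      (∀ t → 1 ≤ t → t ≤ T → ∑ (λ i → w t i * x t i) Q.≤ C t)
    × (∀ t i → 1 ≤ t → t ≤ T → (0ℚ Q.≤ x t i) × (x t i Q.≤ 1ℚ))
    × (∀ t i → 1 ≤ t → t < T → (0ℚ Q.≤ z t i) × (z t i Q.≤ 1ℚ))
    × (∀ t i → 1 ≤ t → t < T →
          (z t i Q.≤ (Q.- x (suc t) i) + x t i + 1ℚ)
        × (z t i Q.≤ x (suc t) i - x t i + 1ℚ))

  SamePoint : Point n → Point n → Set
  SamePoint ⟨ x , z ⟩ ⟨ x' , z' ⟩ =
      (∀ t i → 1 ≤ t → t ≤ T → x t i ≡ x' t i)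
    × (∀ t i → 1 ≤ t → t < T → z t i ≡ z' t i)

  ConvComb : ℚ → Point n → Point n → Point n → Set
  ConvComb λ' S S₁ S₂ =
      (∀ t i → 1 ≤ t → t ≤ T →
         Point.x S t i ≡ λ' * Point.x S₁ t i + (1ℚ - λ') * Point.x S₂ t i)
    × (∀ t i → 1 ≤ t → t < T →
         Point.z S t i ≡ λ' * Point.z S₁ t i + (1ℚ - λ') * Point.z S₂ t i)

  -- Basic solution = extreme point (vertex) of the feasible polyhedron:
  -- feasible, and not a proper convex combination of two distinct feasible points.
  Basic : Point n → Set
  Basic S = Feasible S
    × (∀ S₁ S₂ (λ' : ℚ) → Feasible S₁ → Feasible S₂ →
         0ℚ Q.< λ' → λ' Q.< 1ℚ → ConvComb λ' S S₁ S₂ → SamePoint S S₁)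

  InF : (ℕ → Fin n → ℚ) → ℕ → ℕ → Fin n → Set
  InF x t₀ t₁ i =
      (0ℚ Q.< x t₀ i)
    × (∀ (k : Fin (t₁ ∸ t₀)) → x (t₀ ℕ.+ suc (toℕ k)) i ≡ x (t₀ ℕ.+ toℕ k) i)
    × (x t₁ i Q.< 1ℚ)
    × ((t₀ ≡ 1) ⊎ (x (t₀ ∸ 1) i ≢ x t₀ i))
    × ((t₁ ≡ T) ⊎ (x (suc t₁) i ≢ x t₁ i))

  InF? : ∀ x t₀ t₁ i → Dec (InF x t₀ t₁ i)
  InF? x t₀ t₁ i =
        (0ℚ <? x t₀ i)
    ×-dec (all? (λ k → x (t₀ ℕ.+ suc (toℕ k)) i ≟ x (t₀ ℕ.+ toℕ k) i))
    ×-dec (x t₁ i <? 1ℚ)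
    ×-dec ((t₀ ℕ.≟ 1) ⊎-dec ¬? (x (t₀ ∸ 1) i ≟ x t₀ i))
    ×-dec ((t₁ ℕ.≟ T) ⊎-dec ¬? (x (suc t₁) i ≟ x t₁ i))

  cardF : (ℕ → Fin n → ℚ) → ℕ → ℕ → ℕ
  cardF x t₀ t₁ = length (filter (InF? x t₀ t₁) (allFin n))

-- If F(t₀, t₁) had more than t₁ + 1 - t₀ objects, the t₁ + 1 - t₀ capacity rows of the window,
-- restricted to F, would have a nonzero kernel vector δ.  Moving x by ±εδ on the window
-- (with z = 1 - ∣Δx∣) keeps both points feasible for small ε > 0, because every object of F is
-- fractional and constant on the window and jumps at both of its ends; the two points average
-- to Ŝ, contradicting that Ŝ is a vertex.
module Submission where

open import Defs
open import Data.Nat using (ℕ; suc; _≤_; _<_; _∸_)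
open import Data.Fin using (Fin)
open import Data.Rational using (ℚ; 1ℚ; _-_; ∣_∣)
open import Relation.Binary.PropositionalEquality using (_≡_)

open import Algebra.Properties.Group using (⁻¹-involutive; identityʳ-unique; x∙y⁻¹≈ε⇒x≈y)
open import Data.Nat as ℕ using (zero; z≤n; s≤s)
import Data.Nat.Properties as ℕ
open import Data.Fin using (zero; suc; toℕ; fromℕ<)
open import Data.Fin.Properties using (toℕ-fromℕ<)
open import Data.Rational as Q using (0ℚ; ½; _+_; _*_; -_; 1/_; _⊓_)
open import Data.Rational.Properties as QP using (_≟_)
open import Data.Rational.Solver using (module +-*-Solver)
open import Data.Product using (Σ; ∃; _×_; _,_; proj₁; proj₂)
open import Data.Sum using (inj₁; inj₂; fromInj₂)
open import Data.List using (List; []; _∷_; length; map; filter; allFin; applyUpTo; _++_)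
open import Data.List.Properties using (length-map; length-++; length-applyUpTo; length-tabulate)
open import Data.List.Membership.Propositional using (_∈_)
open import Data.List.Membership.Propositional.Properties using (∈-++⁺ˡ; ∈-++⁺ʳ; ∈-map⁺; ∈-filter⁺; ∈-applyUpTo⁺; ∈-allFin)
open import Data.List.Relation.Unary.All as All using (All; []; _∷_)
open import Data.List.Relation.Unary.All.Properties using (map⁻)
open import Data.List.Relation.Binary.Permutation.Propositional using (_↭_; refl; prep; swap; trans; ↭-sym)
open import Data.List.Relation.Binary.Permutation.Propositional.Properties using (All-resp-↭; ↭-length)
open import Data.Empty using (⊥-elim)
open import Function using (_∘_)
open import Relation.Nullary using (¬_; Dec; yes; no; ¬?; contradiction; _×-dec_; from-yes)
open import Relation.Binary.PropositionalEquality as ≡ using (_≢_; cong; cong₂; subst; subst₂)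
open +-*-Solver

∑-cong : ∀ {n} {f g : Fin n → ℚ} → (∀ i → f i ≡ g i) → ∑ f ≡ ∑ g
∑-cong {zero}  f≗g = ≡.refl
∑-cong {suc n} f≗g = cong₂ _+_ (f≗g zero) (∑-cong (λ i → f≗g (suc i)))

∑-zero : ∀ {n} {f : Fin n → ℚ} → (∀ i → f i ≡ 0ℚ) → ∑ f ≡ 0ℚ
∑-zero {zero}  f≗0 = ≡.refl
∑-zero {suc n} f≗0 = cong₂ _+_ (f≗0 zero) (∑-zero (λ i → f≗0 (suc i)))

∑-linear : ∀ {n} (u v : Fin n → ℚ) s → ∑ (λ i → u i + s * v i) ≡ ∑ u + s * ∑ v
∑-linear {zero}  u v s = solve 1 (λ s → con 0ℚ := con 0ℚ :+ s :* con 0ℚ) ≡.refl s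
∑-linear {suc n} u v s = ≡.trans (cong (u zero + s * v zero +_) (∑-linear (λ i → u (suc i)) (λ i → v (suc i)) s))
  (solve 5 (λ a b s U V → (a :+ s :* b) :+ (U :+ s :* V) := (a :+ U) :+ s :* (b :+ V)) ≡.refl
     (u zero) (v zero) s (∑ λ i → u (suc i)) (∑ λ i → v (suc i)))

dot : ∀ {k} → (Fin k → ℚ) → (Fin k → ℚ) → ℚ
dot f d = ∑ λ j → f j * d j

dot-comm : ∀ {k} (f d : Fin k → ℚ) → dot f d ≡ dot d f
dot-comm f d = ∑-cong λ j → QP.*-comm (f j) (d j)

dot-linearˡ : ∀ {k} (f g d : Fin k → ℚ) s → dot (λ j → f j + s * g j) d ≡ dot f d + s * dot g d
dot-linearˡ f g d s = ≡.trans
  (∑-cong λ j → solve 4 (λ a b c s → (a :+ s :* b) :* c := a :* c :+ s :* (b :* c)) ≡.refl (f j) (g j) (d j) s)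
  (∑-linear (λ j → f j * d j) (λ j → g j * d j) s)

unit : ∀ {k} → Fin k → Fin k → ℚ
unit zero    zero    = 1ℚ
unit zero    (suc j) = 0ℚ
unit (suc i) zero    = 0ℚ
unit (suc i) (suc j) = unit i j

dot-unitˡ : ∀ {k} (i : Fin k) d → dot (unit i) d ≡ d i
dot-unitˡ zero    d = ≡.trans (cong₂ _+_ (QP.*-identityˡ (d zero)) (∑-zero λ j → QP.*-zeroˡ (d (suc j))))
                              (QP.+-identityʳ (d zero))
dot-unitˡ (suc i) d = ≡.trans (cong (_+ dot (unit i) (λ j → d (suc j))) (QP.*-zeroˡ (d zero)))
                              (≡.trans (QP.+-identityˡ _) (dot-unitˡ i (λ j → d (suc j))))

data Pivot {k} (fs : List (Fin (suc k) → ℚ)) : Set where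
  no-pivot : All (λ g → g zero ≡ 0ℚ) fs → Pivot fs
  pivot    : ∀ f rest → f zero ≢ 0ℚ → fs ↭ f ∷ rest → Pivot fs

pivot? : ∀ {k} (fs : List (Fin (suc k) → ℚ)) → Pivot fs
pivot? [] = no-pivot []
pivot? (f ∷ fs) with f zero ≟ 0ℚ
... | no f₀≢0 = pivot f fs f₀≢0 refl
... | yes f₀≡0 with pivot? fs
...   | no-pivot gs₀≡0 = no-pivot (f₀≡0 ∷ gs₀≡0)
...   | pivot g rest g₀≢0 fs↭ = pivot g (f ∷ rest) g₀≢0 (trans (prep f fs↭) (swap f g refl))

module Elimination {k} (f : Fin (suc k) → ℚ) (f₀≢0 : f zero ≢ 0ℚ) where
  instance
    _ : Q.NonZero (f zero)
    _ = Q.≢-nonZero f₀≢0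

  tail : (Fin (suc k) → ℚ) → Fin k → ℚ
  tail g j = g (suc j)

  eliminate : (Fin (suc k) → ℚ) → Fin k → ℚ
  eliminate g j = tail g j + (- (g zero * 1/ f zero)) * tail f j

  back-substitute : (Fin k → ℚ) → Fin (suc k) → ℚ
  back-substitute d zero    = (- dot (tail f) d) * 1/ f zero
  back-substitute d (suc j) = d j

  pivot⊥back-substitute : ∀ d → dot f (back-substitute d) ≡ 0ℚ
  pivot⊥back-substitute d = begin
    f zero * ((- D) * 1/ f zero) + D
      ≡⟨ solve 3 (λ c D c⁻¹ → c :* ((:- D) :* c⁻¹) :+ D := (:- D) :* (c :* c⁻¹) :+ D) ≡.refl (f zero) D (1/ f zero) ⟩
    (- D) * (f zero * 1/ f zero) + D
      ≡⟨ cong (λ u → (- D) * u + D) (QP.*-inverseʳ (f zero)) ⟩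
    (- D) * 1ℚ + D
      ≡⟨ solve 1 (λ D → (:- D) :* con 1ℚ :+ D := con 0ℚ) ≡.refl D ⟩
    0ℚ
      ∎
    where
    open ≡.≡-Reasoning
    D = dot (tail f) d

  back-substitute-preserves-⊥ : ∀ g d → dot (eliminate g) d ≡ 0ℚ → dot g (back-substitute d) ≡ 0ℚ
  back-substitute-preserves-⊥ g d eliminated⊥d = begin
    g zero * ((- D) * 1/ f zero) + G
      ≡⟨ solve 4 (λ g₀ D c⁻¹ G → g₀ :* ((:- D) :* c⁻¹) :+ G := G :+ (:- (g₀ :* c⁻¹)) :* D) ≡.refl (g zero) D (1/ f zero) G ⟩
    G + (- (g zero * 1/ f zero)) * D
      ≡⟨ dot-linearˡ (tail g) (tail f) d (- (g zero * 1/ f zero)) ⟨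
    dot (eliminate g) d
      ≡⟨ eliminated⊥d ⟩
    0ℚ
      ∎
    where
    open ≡.≡-Reasoning
    D = dot (tail f) d
    G = dot (tail g) d

underdetermined⇒nonzero-solution : ∀ k (fs : List (Fin k → ℚ)) → length fs ℕ.< k →
  Σ (Fin k → ℚ) λ d → (∃ λ i → d i ≢ 0ℚ) × All (λ f → dot f d ≡ 0ℚ) fs
underdetermined⇒nonzero-solution (suc k) fs len< with pivot? fs
... | no-pivot gs₀≡0 = unit zero , (zero , QP.1≢0) ,
        All.map (λ {g} g₀≡0 → ≡.trans (dot-comm g (unit zero)) (≡.trans (dot-unitˡ zero g) g₀≡0)) gs₀≡0
... | pivot f rest f₀≢0 fs↭
  with underdetermined⇒nonzero-solution k (map (Elimination.eliminate f f₀≢0) rest)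
         (subst (ℕ._< k) (≡.sym (length-map _ rest)) (ℕ.≤-pred (subst (ℕ._< suc k) (↭-length fs↭) len<)))
...   | d , (i , dᵢ≢0) , rest⊥d = back-substitute d , (suc i , dᵢ≢0) ,
        All-resp-↭ (↭-sym fs↭) (pivot⊥back-substitute d ∷ All.map (λ {g} → back-substitute-preserves-⊥ g d) (map⁻ rest⊥d))
  where open Elimination f f₀≢0

p≤∣p∣ : ∀ p → p Q.≤ ∣ p ∣
p≤∣p∣ p with QP.∣p∣≡p∨∣p∣≡-p p
... | inj₁ ∣p∣≡p  = QP.≤-reflexive (≡.sym ∣p∣≡p)
... | inj₂ ∣p∣≡-p = QP.≤-trans p≤0 (QP.0≤∣p∣ p)
  where
  p≤0 : p Q.≤ 0ℚ
  p≤0 = subst (Q._≤ 0ℚ) (⁻¹-involutive QP.+-0-group p) (QP.neg-antimono-≤ (subst (0ℚ Q.≤_) ∣p∣≡-p (QP.0≤∣p∣ p)))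

-p≤∣p∣ : ∀ p → - p Q.≤ ∣ p ∣
-p≤∣p∣ p = subst (- p Q.≤_) (QP.∣-p∣≡∣p∣ p) (p≤∣p∣ (- p))

∣p∣≤q⇒-q≤p≤q : ∀ {p q} → ∣ p ∣ Q.≤ q → - q Q.≤ p × p Q.≤ q
∣p∣≤q⇒-q≤p≤q {p} ∣p∣≤q =
  subst (_ Q.≤_) (⁻¹-involutive QP.+-0-group p) (QP.neg-antimono-≤ (QP.≤-trans (-p≤∣p∣ p) ∣p∣≤q)) ,
  QP.≤-trans (p≤∣p∣ p) ∣p∣≤q

-q≤p≤q⇒∣p∣≤q : ∀ {p q} → - q Q.≤ p → p Q.≤ q → ∣ p ∣ Q.≤ q
-q≤p≤q⇒∣p∣≤q {p} {q} -q≤p p≤q with QP.∣p∣≡p∨∣p∣≡-p p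
... | inj₁ ∣p∣≡p  = subst (Q._≤ q) (≡.sym ∣p∣≡p) p≤q
... | inj₂ ∣p∣≡-p = subst₂ Q._≤_ (≡.sym ∣p∣≡-p) (⁻¹-involutive QP.+-0-group q) (QP.neg-antimono-≤ -q≤p)

p<q⇒0<q-p : ∀ {p q} → p Q.< q → 0ℚ Q.< q - p
p<q⇒0<q-p {p} {q} p<q = subst (Q._< q - p) (QP.+-inverseʳ p) (QP.+-monoˡ-< (- p) p<q)

p≢q⇒0<∣q-p∣ : ∀ {p q} → p ≢ q → 0ℚ Q.< ∣ q - p ∣
p≢q⇒0<∣q-p∣ {p} {q} p≢q = QP.positive⁻¹ ∣ q - p ∣ {{QP.nonNeg∧nonZero⇒pos ∣ q - p ∣}}
  where
  ∣q-p∣≢0 : ∣ q - p ∣ ≢ 0ℚ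
  ∣q-p∣≢0 ∣q-p∣≡0 = p≢q (≡.sym (x∙y⁻¹≈ε⇒x≈y QP.+-0-group q p (QP.∣p∣≡0⇒p≡0 (q - p) ∣q-p∣≡0)))
  instance
    _ : Q.NonNegative ∣ q - p ∣
    _ = Q.nonNegative (QP.0≤∣p∣ (q - p))
    _ : Q.NonZero ∣ q - p ∣
    _ = Q.≢-nonZero ∣q-p∣≢0

p≢0∧p*q≡0⇒q≡0 : ∀ {p q} → p ≢ 0ℚ → p * q ≡ 0ℚ → q ≡ 0ℚ
p≢0∧p*q≡0⇒q≡0 {p} {q} p≢0 p*q≡0 = begin
  q               ≡⟨ QP.*-identityˡ q ⟨
  1ℚ * q          ≡⟨ cong (_* q) (QP.*-inverseˡ p) ⟨
  1/ p * p * q    ≡⟨ QP.*-assoc (1/ p) p q ⟩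
  1/ p * (p * q)  ≡⟨ cong (1/ p *_) p*q≡0 ⟩
  1/ p * 0ℚ       ≡⟨ QP.*-zeroʳ (1/ p) ⟩
  0ℚ              ∎
  where
  open ≡.≡-Reasoning
  instance
    _ : Q.NonZero p
    _ = Q.≢-nonZero p≢0

∣a+e∣+∣a-e∣≡a+a : ∀ {a e} → ∣ e ∣ Q.≤ a → ∣ a + e ∣ + ∣ a - e ∣ ≡ a + a
∣a+e∣+∣a-e∣≡a+a {a} {e} ∣e∣≤a = begin
  ∣ a + e ∣ + ∣ a - e ∣ ≡⟨ cong₂ _+_ (QP.0≤p⇒∣p∣≡p 0≤a+e) (QP.0≤p⇒∣p∣≡p 0≤a-e) ⟩
  (a + e) + (a - e)     ≡⟨ solve 2 (λ a e → (a :+ e) :+ (a :- e) := a :+ a) ≡.refl a e ⟩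
  a + a                 ∎
  where
  open ≡.≡-Reasoning
  -a≤e≤a = ∣p∣≤q⇒-q≤p≤q ∣e∣≤a
  0≤a+e : 0ℚ Q.≤ a + e
  0≤a+e = subst (Q._≤ a + e) (QP.+-inverseʳ a) (QP.+-monoʳ-≤ a (proj₁ -a≤e≤a))
  0≤a-e : 0ℚ Q.≤ a - e
  0≤a-e = subst (Q._≤ a - e) (QP.+-inverseʳ a) (QP.+-monoʳ-≤ a (QP.neg-antimono-≤ (proj₂ -a≤e≤a)))

∣a+e∣+∣a-e∣≡∣a∣+∣a∣ : ∀ a e → ∣ e ∣ Q.≤ ∣ a ∣ → ∣ a + e ∣ + ∣ a - e ∣ ≡ ∣ a ∣ + ∣ a ∣
∣a+e∣+∣a-e∣≡∣a∣+∣a∣ a e ∣e∣≤∣a∣ with QP.∣p∣≡p∨∣p∣≡-p a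
... | inj₁ ∣a∣≡a = subst (λ u → ∣ a + e ∣ + ∣ a - e ∣ ≡ u + u) (≡.sym ∣a∣≡a)
                     (∣a+e∣+∣a-e∣≡a+a (subst (∣ e ∣ Q.≤_) ∣a∣≡a ∣e∣≤∣a∣))
... | inj₂ ∣a∣≡-a = begin
  ∣ a + e ∣ + ∣ a - e ∣         ≡⟨ cong₂ _+_ (∣∣-neg (solve 2 (λ a e → :- a :+ :- e := :- (a :+ e)) ≡.refl a e))
                                             (∣∣-neg (solve 2 (λ a e → :- a :- :- e := :- (a :- e)) ≡.refl a e)) ⟩
  ∣ - a + - e ∣ + ∣ - a - - e ∣ ≡⟨ ∣a+e∣+∣a-e∣≡a+a (subst₂ Q._≤_ (≡.sym (QP.∣-p∣≡∣p∣ e)) ∣a∣≡-a ∣e∣≤∣a∣) ⟩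
  - a + - a                     ≡⟨ cong (λ u → u + u) ∣a∣≡-a ⟨
  ∣ a ∣ + ∣ a ∣                 ∎
  where
  open ≡.≡-Reasoning
  ∣∣-neg : ∀ {p q} → p ≡ - q → ∣ q ∣ ≡ ∣ p ∣
  ∣∣-neg {p} {q} p≡-q = ≡.trans (≡.sym (QP.∣-p∣≡∣p∣ q)) (cong ∣_∣ (≡.sym p≡-q))

1-∣a∣≡½-combination : ∀ a e → ∣ e ∣ Q.≤ ∣ a ∣ →
  1ℚ - ∣ a ∣ ≡ ½ * (1ℚ - ∣ a + e ∣) + (1ℚ - ½) * (1ℚ - ∣ a - e ∣)
1-∣a∣≡½-combination a e ∣e∣≤∣a∣ = begin
  1ℚ - ∣ a ∣
    ≡⟨ solve 1 (λ A → con 1ℚ :- A := con 1ℚ :- con ½ :* (A :+ A)) ≡.refl ∣ a ∣ ⟩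
  1ℚ - ½ * (∣ a ∣ + ∣ a ∣)
    ≡⟨ cong (λ u → 1ℚ - ½ * u) (∣a+e∣+∣a-e∣≡∣a∣+∣a∣ a e ∣e∣≤∣a∣) ⟨
  1ℚ - ½ * (∣ a + e ∣ + ∣ a - e ∣)
    ≡⟨ solve 2 (λ X Y → con 1ℚ :- con ½ :* (X :+ Y) := con ½ :* (con 1ℚ :- X) :+ (con 1ℚ :- con ½) :* (con 1ℚ :- Y))
         ≡.refl ∣ a + e ∣ ∣ a - e ∣ ⟩
  ½ * (1ℚ - ∣ a + e ∣) + (1ℚ - ½) * (1ℚ - ∣ a - e ∣)
    ∎
  where open ≡.≡-Reasoning

∣s*[q-q]∣≤∣p∣ : ∀ s q p → ∣ s * (q - q) ∣ Q.≤ ∣ p ∣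
∣s*[q-q]∣≤∣p∣ s q p =
  subst (Q._≤ ∣ p ∣) (cong ∣_∣ (≡.sym (≡.trans (cong (s *_) (QP.+-inverseʳ q)) (QP.*-zeroʳ s)))) (QP.0≤∣p∣ p)

∣s*q∣≡∣s*[0-q]∣ : ∀ s q → ∣ s * q ∣ ≡ ∣ s * (0ℚ - q) ∣
∣s*q∣≡∣s*[0-q]∣ s q = ≡.trans (≡.sym (QP.∣-p∣≡∣p∣ (s * q)))
  (cong ∣_∣ (solve 2 (λ s q → :- (s :* q) := s :* (con 0ℚ :- q)) ≡.refl s q))

Box : ℚ → Set
Box q = 0ℚ Q.≤ q × q Q.≤ 1ℚ

∣q-p∣≤1 : ∀ {p q} → Box p → Box q → ∣ q - p ∣ Q.≤ 1ℚ
∣q-p∣≤1 {p} {q} (0≤p , p≤1) (0≤q , q≤1) = -q≤p≤q⇒∣p∣≤q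
  (subst (- 1ℚ Q.≤_) (solve 2 (λ p q → :- (p :- q) := q :- p) ≡.refl p q)
    (QP.neg-antimono-≤ (QP.+-mono-≤ p≤1 (QP.neg-antimono-≤ 0≤q))))
  (QP.+-mono-≤ q≤1 (QP.neg-antimono-≤ 0≤p))

box-1-∣q-p∣ : ∀ {p q} → Box p → Box q → Box (1ℚ - ∣ q - p ∣)
box-1-∣q-p∣ {p} {q} p∈box q∈box =
  subst (Q._≤ 1ℚ - ∣ q - p ∣) (QP.+-inverseʳ 1ℚ) (QP.+-monoʳ-≤ 1ℚ (QP.neg-antimono-≤ (∣q-p∣≤1 p∈box q∈box))) ,
  subst (1ℚ - ∣ q - p ∣ Q.≤_) (QP.+-identityʳ 1ℚ) (QP.+-monoʳ-≤ 1ℚ (QP.neg-antimono-≤ (QP.0≤∣p∣ (q - p))))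

1-∣q-p∣≤1∓[q-p] : ∀ p q → (1ℚ - ∣ q - p ∣ Q.≤ (- q) + p + 1ℚ) × (1ℚ - ∣ q - p ∣ Q.≤ q - p + 1ℚ)
1-∣q-p∣≤1∓[q-p] p q =
  subst (1ℚ - ∣ q - p ∣ Q.≤_) (solve 2 (λ p q → con 1ℚ :- (q :- p) := (:- q) :+ p :+ con 1ℚ) ≡.refl p q)
    (QP.+-monoʳ-≤ 1ℚ (QP.neg-antimono-≤ (p≤∣p∣ (q - p)))) ,
  subst (1ℚ - ∣ q - p ∣ Q.≤_) (solve 2 (λ p q → con 1ℚ :- (:- (q :- p)) := q :- p :+ con 1ℚ) ≡.refl p q)
    (QP.+-monoʳ-≤ 1ℚ (QP.neg-antimono-≤ (-p≤∣p∣ (q - p))))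

box-+ : ∀ {v e} → ∣ e ∣ Q.≤ v → ∣ e ∣ Q.≤ 1ℚ - v → Box (v + e)
box-+ {v} {e} ∣e∣≤v ∣e∣≤1-v =
  subst (Q._≤ v + e) (QP.+-inverseʳ v) (QP.+-monoʳ-≤ v (proj₁ (∣p∣≤q⇒-q≤p≤q ∣e∣≤v))) ,
  subst (v + e Q.≤_) (solve 1 (λ v → v :+ (con 1ℚ :- v) := con 1ℚ) ≡.refl v)
    (QP.+-monoʳ-≤ v (proj₂ (∣p∣≤q⇒-q≤p≤q ∣e∣≤1-v)))

NearZero : (ℚ → Set) → Set
NearZero P = Σ ℚ λ r → 0ℚ Q.< r × (∀ s → ∣ s ∣ Q.≤ r → P s)

0<p⊓q : ∀ {p q} → 0ℚ Q.< p → 0ℚ Q.< q → 0ℚ Q.< p ⊓ q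
0<p⊓q {p} {q} 0<p 0<q with QP.⊓-sel p q
... | inj₁ p⊓q≡p = subst (0ℚ Q.<_) (≡.sym p⊓q≡p) 0<p
... | inj₂ p⊓q≡q = subst (0ℚ Q.<_) (≡.sym p⊓q≡q) 0<q

module _ {P R : ℚ → Set} where

  nearZero-map : (∀ {s} → P s → R s) → NearZero P → NearZero R
  nearZero-map P⇒R (r , 0<r , P-near) = r , 0<r , λ s ∣s∣≤r → P⇒R (P-near s ∣s∣≤r)

  nearZero-× : NearZero P → NearZero R → NearZero (λ s → P s × R s)
  nearZero-× (r , 0<r , P-near) (r′ , 0<r′ , R-near) = r ⊓ r′ , 0<p⊓q 0<r 0<r′ , λ s ∣s∣≤r⊓r′ →
    P-near s (QP.≤-trans ∣s∣≤r⊓r′ (QP.p⊓q≤p r r′)) , R-near s (QP.≤-trans ∣s∣≤r⊓r′ (QP.p⊓q≤q r r′))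

nearZero-everywhere : ∀ {P : ℚ → Set} → (∀ s → P s) → NearZero P
nearZero-everywhere P-all = 1ℚ , QP.positive⁻¹ 1ℚ , λ s _ → P-all s

nearZero-→ : ∀ {A : Set} {P : ℚ → Set} → Dec A → (A → NearZero P) → NearZero (λ s → A → P s)
nearZero-→ (yes a) P-near = nearZero-map (λ p _ → p) (P-near a)
nearZero-→ (no ¬a) _      = nearZero-everywhere λ _ a → contradiction a ¬a

nearZero-∀ : ∀ {n} {P : Fin n → ℚ → Set} → (∀ i → NearZero (P i)) → NearZero (λ s → ∀ i → P i s)
nearZero-∀ {zero}  P-near = nearZero-everywhere λ _ ()
nearZero-∀ {suc n} P-near = nearZero-map (λ { (p₀ , pₛ) → λ { zero → p₀ ; (suc i) → pₛ i } })
  (nearZero-× (P-near zero) (nearZero-∀ (λ i → P-near (suc i))))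

nearZero-∣∣≤ : ∀ {g} → 0ℚ Q.< g → NearZero (λ e → ∣ e ∣ Q.≤ g)
nearZero-∣∣≤ {g} 0<g = g , 0<g , λ _ ∣e∣≤g → ∣e∣≤g

nearZero-scale : ∀ {P : ℚ → Set} → NearZero P → ∀ c → NearZero (λ s → P (s * c))
nearZero-scale {P} (r , 0<r , P-near) c = ρ , 0<ρ , λ s ∣s∣≤ρ → P-near (s * c) (∣s*c∣≤r s ∣s∣≤ρ)
  where
  1+∣c∣ = 1ℚ + ∣ c ∣
  0<1+∣c∣ : 0ℚ Q.< 1+∣c∣
  0<1+∣c∣ = QP.<-≤-trans (QP.positive⁻¹ 1ℚ) (subst (Q._≤ 1+∣c∣) (QP.+-identityʳ 1ℚ) (QP.+-monoʳ-≤ 1ℚ (QP.0≤∣p∣ c)))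
  instance
    _ : Q.Positive 1+∣c∣
    _ = Q.positive 0<1+∣c∣
    _ : Q.NonZero 1+∣c∣
    _ = QP.pos⇒nonZero 1+∣c∣
    _ : Q.Positive r
    _ = Q.positive 0<r
    _ : Q.Positive (1/ 1+∣c∣)
    _ = QP.1/pos⇒pos 1+∣c∣
  ρ = r * 1/ 1+∣c∣
  0<ρ : 0ℚ Q.< ρ
  0<ρ = QP.positive⁻¹ ρ {{QP.pos*pos⇒pos r (1/ 1+∣c∣)}}
  ∣s*c∣≤r : ∀ s → ∣ s ∣ Q.≤ ρ → ∣ s * c ∣ Q.≤ r
  ∣s*c∣≤r s ∣s∣≤ρ = begin
    ∣ s * c ∣              ≡⟨ QP.∣p*q∣≡∣p∣*∣q∣ s c ⟩
    ∣ s ∣ * ∣ c ∣          ≤⟨ QP.*-monoʳ-≤-nonNeg ∣ c ∣ {{Q.nonNegative (QP.0≤∣p∣ c)}} ∣s∣≤ρ ⟩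
    ρ * ∣ c ∣              ≤⟨ QP.*-monoˡ-≤-nonNeg ρ {{Q.nonNegative (QP.<⇒≤ 0<ρ)}} ∣c∣≤1+∣c∣ ⟩
    ρ * 1+∣c∣              ≡⟨ QP.*-assoc r (1/ 1+∣c∣) 1+∣c∣ ⟩
    r * (1/ 1+∣c∣ * 1+∣c∣) ≡⟨ cong (r *_) (QP.*-inverseˡ 1+∣c∣) ⟩
    r * 1ℚ                 ≡⟨ QP.*-identityʳ r ⟩
    r                      ∎
    where
    open QP.≤-Reasoning
    ∣c∣≤1+∣c∣ : ∣ c ∣ Q.≤ 1+∣c∣
    ∣c∣≤1+∣c∣ = subst (Q._≤ 1+∣c∣) (QP.+-identityˡ ∣ c ∣) (QP.+-monoˡ-≤ ∣ c ∣ (QP.<⇒≤ (QP.positive⁻¹ 1ℚ)))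

module _ (I : Instance) where
  open Instance I

  zOf : (ℕ → Fin n → ℚ) → ℕ → Fin n → ℚ
  zOf x t i = 1ℚ - ∣ x (suc t) i - x t i ∣

  shift : (ℕ → Fin n → ℚ) → ℚ → (ℕ → Fin n → ℚ) → ℕ → Fin n → ℚ
  shift x s d t i = x t i + s * d t i

  along : (ℕ → Fin n → ℚ) → ℚ → (ℕ → Fin n → ℚ) → Point n
  along x s d = ⟨ shift x s d , zOf (shift x s d) ⟩

  JumpsWithin : (ℕ → Fin n → ℚ) → ℚ → (ℕ → Fin n → ℚ) → Set
  JumpsWithin x s d = ∀ t i → 1 ≤ t → t < T → ∣ s * (d (suc t) i - d t i) ∣ Q.≤ ∣ x (suc t) i - x t i ∣

  feasible-zOf : ∀ {x} →
    (∀ t → 1 ≤ t → t ≤ T → ∑ (λ i → w t i * x t i) Q.≤ C t) →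
    (∀ t i → 1 ≤ t → t ≤ T → Box (x t i)) →
    Feasible I ⟨ x , zOf x ⟩
  feasible-zOf {x} capacity box = capacity , box ,
    (λ t i 1≤t t<T → box-1-∣q-p∣ (box t i 1≤t (ℕ.<⇒≤ t<T)) (box (suc t) i (s≤s z≤n) t<T)) ,
    (λ t i _ _ → 1-∣q-p∣≤1∓[q-p] (x t i) (x (suc t) i))

  along-feasible : ∀ {S} s d → Feasible I S →
    (∀ t → 1 ≤ t → t ≤ T → ∑ (λ i → w t i * d t i) ≡ 0ℚ) →
    (∀ t i → 1 ≤ t → t ≤ T → Box (shift (Point.x S) s d t i)) →
    Feasible I (along (Point.x S) s d)
  along-feasible {S} s d (capacity , _) w·d≡0 box = feasible-zOf capacity′ box
    where
    x = Point.x S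
    capacity′ : ∀ t → 1 ≤ t → t ≤ T → ∑ (λ i → w t i * shift x s d t i) Q.≤ C t
    capacity′ t 1≤t t≤T = subst (Q._≤ C t) (≡.sym (begin
      ∑ (λ i → w t i * shift x s d t i)
        ≡⟨ ∑-cong (λ i → solve 4 (λ w x s d → w :* (x :+ s :* d) := w :* x :+ s :* (w :* d)) ≡.refl (w t i) (x t i) s (d t i)) ⟩
      ∑ (λ i → w t i * x t i + s * (w t i * d t i))
        ≡⟨ ∑-linear (λ i → w t i * x t i) (λ i → w t i * d t i) s ⟩
      ∑ (λ i → w t i * x t i) + s * ∑ (λ i → w t i * d t i)
        ≡⟨ cong (λ u → ∑ (λ i → w t i * x t i) + s * u) (w·d≡0 t 1≤t t≤T) ⟩
      ∑ (λ i → w t i * x t i) + s * 0ℚ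
        ≡⟨ solve 2 (λ a s → a :+ s :* con 0ℚ := a) ≡.refl _ s ⟩
      ∑ (λ i → w t i * x t i)
        ∎))
      (capacity t 1≤t t≤T)
      where open ≡.≡-Reasoning

  -- Each jump a of x moves by ±e with ∣ e ∣ ≤ ∣ a ∣, and then 1 - ∣ a ∣ is the average of
  -- 1 - ∣ a + e ∣ and 1 - ∣ a - e ∣.
  midpoint-along : ∀ {S} s d → (∀ t i → 1 ≤ t → t < T → Point.z S t i ≡ zOf (Point.x S) t i) →
    JumpsWithin (Point.x S) s d → ConvComb I ½ S (along (Point.x S) s d) (along (Point.x S) (- s) d)
  midpoint-along {S} s d z≡zOf jumps =
    (λ t i _ _ → solve 3 (λ x s d → x := con ½ :* (x :+ s :* d) :+ (con 1ℚ :- con ½) :* (x :+ (:- s) :* d)) ≡.refl (x t i) s (d t i)) ,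
    λ t i 1≤t t<T → begin
      Point.z S t i
        ≡⟨ z≡zOf t i 1≤t t<T ⟩
      1ℚ - ∣ a t i ∣
        ≡⟨ 1-∣a∣≡½-combination (a t i) (e t i) (jumps t i 1≤t t<T) ⟩
      ½ * (1ℚ - ∣ a t i + e t i ∣) + (1ℚ - ½) * (1ℚ - ∣ a t i - e t i ∣)
        ≡⟨ cong₂ (λ u v → ½ * (1ℚ - ∣ u ∣) + (1ℚ - ½) * (1ℚ - ∣ v ∣))
             (solve 5 (λ x₁ x₀ s d₁ d₀ → x₁ :- x₀ :+ s :* (d₁ :- d₀) := (x₁ :+ s :* d₁) :- (x₀ :+ s :* d₀)) ≡.refl
                (x (suc t) i) (x t i) s (d (suc t) i) (d t i))
             (solve 5 (λ x₁ x₀ s d₁ d₀ → x₁ :- x₀ :- s :* (d₁ :- d₀) := (x₁ :+ (:- s) :* d₁) :- (x₀ :+ (:- s) :* d₀)) ≡.refl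
                (x (suc t) i) (x t i) s (d (suc t) i) (d t i)) ⟩
      ½ * zOf (shift x s d) t i + (1ℚ - ½) * zOf (shift x (- s) d) t i
        ∎
    where
    open ≡.≡-Reasoning
    x = Point.x S
    a e : ℕ → Fin n → ℚ
    a t i = x (suc t) i - x t i
    e t i = s * (d (suc t) i - d t i)

  basic⇒direction≡0 : ∀ {S} s d → Basic I S →
    (∀ t i → 1 ≤ t → t < T → Point.z S t i ≡ zOf (Point.x S) t i) →
    s ≢ 0ℚ → JumpsWithin (Point.x S) s d →
    Feasible I (along (Point.x S) s d) → Feasible I (along (Point.x S) (- s) d) →
    ∀ t i → 1 ≤ t → t ≤ T → d t i ≡ 0ℚ
  basic⇒direction≡0 {S} s d (_ , extreme) z≡zOf s≢0 jumps feasible⁺ feasible⁻ t i 1≤t t≤T =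
    p≢0∧p*q≡0⇒q≡0 s≢0 (identityʳ-unique QP.+-0-group (Point.x S t i) (s * d t i)
      (≡.sym (proj₁ same t i 1≤t t≤T)))
    where
    same = extreme _ _ ½ feasible⁺ feasible⁻ (QP.positive⁻¹ ½) (from-yes (½ QP.<? 1ℚ))
             (midpoint-along s d z≡zOf jumps)

constant-run : ∀ {A : Set} (f : ℕ → A) a m → (∀ (k : Fin m) → f (a ℕ.+ suc (toℕ k)) ≡ f (a ℕ.+ toℕ k)) →
  ∀ k → k ≤ m → f (a ℕ.+ k) ≡ f a
constant-run f a m step zero    _   = cong f (ℕ.+-identityʳ a)
constant-run f a m step (suc k) k<m = ≡.trans
  (subst (λ j → f (a ℕ.+ suc j) ≡ f (a ℕ.+ j)) (toℕ-fromℕ< k<m) (step (fromℕ< k<m)))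
  (constant-run f a m step k (ℕ.<⇒≤ k<m))

length-filter+length-filter-¬ : ∀ {A : Set} {P : A → Set} (P? : ∀ a → Dec (P a)) xs →
  length (filter P? xs) ℕ.+ length (filter (¬? ∘ P?) xs) ≡ length xs
length-filter+length-filter-¬ P? [] = ≡.refl
length-filter+length-filter-¬ P? (y ∷ ys) with P? y
... | yes _ = cong suc (length-filter+length-filter-¬ P? ys)
... | no  _ = ≡.trans (ℕ.+-suc _ _) (cong suc (length-filter+length-filter-¬ P? ys))

module Window (I : Instance) (S : Point (Instance.n I)) (feasible : Feasible I S)
  (t₀ t₁ : ℕ) (1≤t₀ : 1 ≤ t₀) (t₀≤t₁ : t₀ ≤ t₁) (t₁≤T : t₁ ≤ Instance.T I) where

  open Instance I

  x : ℕ → Fin n → ℚ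
  x = Point.x S

  InWindow : ℕ → Set
  InWindow t = t₀ ≤ t × t ≤ t₁

  inWindow? : ∀ t → Dec (InWindow t)
  inWindow? t = t₀ ℕ.≤? t ×-dec t ℕ.≤? t₁

  window : (Fin n → ℚ) → ℕ → Fin n → ℚ
  window δ t i with inWindow? t
  ... | yes _ = δ i
  ... | no  _ = 0ℚ

  window-in : ∀ δ {t} i → InWindow t → window δ t i ≡ δ i
  window-in δ {t} i t∈ with inWindow? t
  ... | yes _  = ≡.refl
  ... | no  t∉ = contradiction t∈ t∉

  InWindow⇒≤T : ∀ {t} → InWindow t → 1 ≤ t × t ≤ T
  InWindow⇒≤T (t₀≤t , t≤t₁) = ℕ.≤-trans 1≤t₀ t₀≤t , ℕ.≤-trans t≤t₁ t₁≤T

  leaving : ∀ {t} → InWindow t → ¬ InWindow (suc t) → t ≡ t₁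
  leaving (t₀≤t , t≤t₁) 1+t∉ = ℕ.≤-antisym t≤t₁ (ℕ.≮⇒≥ λ t<t₁ → 1+t∉ (ℕ.m≤n⇒m≤1+n t₀≤t , t<t₁))

  entering : ∀ {t} → ¬ InWindow t → InWindow (suc t) → suc t ≡ t₀
  entering t∉ (t₀≤1+t , 1+t≤t₁) = ℕ.≤-antisym (ℕ.≮⇒≥ λ t₀<1+t → t∉ (ℕ.≤-pred t₀<1+t , ℕ.<⇒≤ 1+t≤t₁)) t₀≤1+t

  InF-constant : ∀ {i t} → InF I x t₀ t₁ i → InWindow t → x t i ≡ x t₀ i
  InF-constant {i} {t} (_ , step , _) (t₀≤t , t≤t₁) =
    subst (λ u → x u i ≡ x t₀ i) (ℕ.m+[n∸m]≡n t₀≤t)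
      (constant-run (λ u → x u i) t₀ (t₁ ∸ t₀) step (t ∸ t₀) (ℕ.∸-monoˡ-≤ t₀ t≤t₁))

  Supported Balanced : (Fin n → ℚ) → Set
  Supported δ = ∀ i → δ i ≢ 0ℚ → InF I x t₀ t₁ i
  Balanced  δ = ∀ t → InWindow t → ∑ (λ i → w t i * δ i) ≡ 0ℚ

  record Admissible (e : ℚ) (i : Fin n) : Set where
    field
      box              : ∀ t → InWindow t → Box (x t i + e)
      below-entry-jump : t₀ ≢ 1 → ∣ e ∣ Q.≤ ∣ x t₀ i - x (t₀ ∸ 1) i ∣
      below-exit-jump  : t₁ ≢ T → ∣ e ∣ Q.≤ ∣ x (suc t₁) i - x t₁ i ∣
  open Admissible

  admissible-0 : ∀ i → Admissible 0ℚ i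
  admissible-0 i = record
    { box              = λ t t∈ → subst Box (≡.sym (QP.+-identityʳ (x t i)))
                           (proj₁ (proj₂ feasible) t i (proj₁ (InWindow⇒≤T t∈)) (proj₂ (InWindow⇒≤T t∈)))
    ; below-entry-jump = λ _ → QP.0≤∣p∣ _
    ; below-exit-jump  = λ _ → QP.0≤∣p∣ _
    }

  admissible-nearZero-F : ∀ {i} → InF I x t₀ t₁ i → NearZero (λ e → Admissible e i)
  admissible-nearZero-F {i} i∈F@(0<v , _ , x[t₁]<1 , entry , exit) =
    nearZero-map (λ { (v+e∈box , entry-jump , exit-jump) → record
        { box              = λ t t∈ → subst (λ u → Box (u + _)) (≡.sym (InF-constant i∈F t∈)) v+e∈box
        ; below-entry-jump = entry-jump
        ; below-exit-jump  = exit-jump } })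
      (nearZero-× (nearZero-map (λ { (≤v , ≤1-v) → box-+ ≤v ≤1-v })
                    (nearZero-× (nearZero-∣∣≤ 0<v) (nearZero-∣∣≤ (p<q⇒0<q-p v<1))))
      (nearZero-× (nearZero-→ (¬? (t₀ ℕ.≟ 1)) λ t₀≢1 →
                     nearZero-∣∣≤ (p≢q⇒0<∣q-p∣ (fromInj₂ (⊥-elim ∘ t₀≢1) entry)))
                  (nearZero-→ (¬? (t₁ ℕ.≟ T)) λ t₁≢T →
                     nearZero-∣∣≤ (p≢q⇒0<∣q-p∣ (≡.≢-sym (fromInj₂ (⊥-elim ∘ t₁≢T) exit))))))
    where
    v<1 : x t₀ i Q.< 1ℚ
    v<1 = subst (Q._< 1ℚ) (InF-constant i∈F (t₀≤t₁ , ℕ.≤-refl)) x[t₁]<1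

  admissible-nearZero : ∀ {δ} → Supported δ → ∀ i → NearZero (λ s → Admissible (s * δ i) i)
  admissible-nearZero {δ} supported i with δ i ≟ 0ℚ
  ... | yes δᵢ≡0 = nearZero-everywhere λ s →
          subst (λ e → Admissible e i) (≡.sym (≡.trans (cong (s *_) δᵢ≡0) (QP.*-zeroʳ s))) (admissible-0 i)
  ... | no  δᵢ≢0 = nearZero-scale (admissible-nearZero-F (supported i δᵢ≢0)) (δ i)

  module _ {δ : Fin n → ℚ} {s : ℚ} (admissible : ∀ i → Admissible (s * δ i) i) where

    window-feasible : Balanced δ → Feasible I (along I x s (window δ))
    window-feasible balanced = along-feasible I s (window δ) feasible w·window≡0 box′
      where
      w·window≡0 : ∀ t → 1 ≤ t → t ≤ T → ∑ (λ i → w t i * window δ t i) ≡ 0ℚ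
      w·window≡0 t _ _ with inWindow? t
      ... | yes t∈ = balanced t t∈
      ... | no  _  = ∑-zero λ i → QP.*-zeroʳ (w t i)
      box′ : ∀ t i → 1 ≤ t → t ≤ T → Box (shift I x s (window δ) t i)
      box′ t i 1≤t t≤T with inWindow? t
      ... | yes t∈ = box (admissible i) t t∈
      ... | no  _  = subst Box (≡.sym (≡.trans (cong (x t i +_) (QP.*-zeroʳ s)) (QP.+-identityʳ (x t i))))
                       (proj₁ (proj₂ feasible) t i 1≤t t≤T)

    -- window δ jumps only at the ends of the window, and every object of F jumps there too.
    window-jumps : JumpsWithin I x s (window δ)
    window-jumps t i 1≤t t<T with inWindow? t | inWindow? (suc t)
    ... | yes _  | yes _    = ∣s*[q-q]∣≤∣p∣ s (δ i) _
    ... | no  _  | no  _    = ∣s*[q-q]∣≤∣p∣ s 0ℚ _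
    ... | yes t∈ | no  1+t∉ =
      subst₂ Q._≤_ (∣s*q∣≡∣s*[0-q]∣ s (δ i)) (cong (λ u → ∣ x (suc u) i - x u i ∣) (≡.sym t≡t₁))
        (below-exit-jump (admissible i) λ t₁≡T → ℕ.<-irrefl (≡.trans t≡t₁ t₁≡T) t<T)
      where
      t≡t₁ = leaving t∈ 1+t∉
    ... | no  t∉ | yes 1+t∈ =
      subst₂ Q._≤_ (cong (λ u → ∣ s * u ∣) (≡.sym (QP.+-identityʳ (δ i))))
                   (cong (λ u → ∣ x u i - x (u ∸ 1) i ∣) (≡.sym 1+t≡t₀))
        (below-entry-jump (admissible i) λ t₀≡1 → ℕ.<-irrefl (≡.sym (ℕ.suc-injective (≡.trans 1+t≡t₀ t₀≡1))) 1≤t)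
      where
      1+t≡t₀ = entering t∉ 1+t∈

  supported-balanced⇒zero : Basic I S → (∀ t i → 1 ≤ t → t < T → Point.z S t i ≡ zOf I x t i) →
    ∀ {δ} → Supported δ → Balanced δ → ∀ i → δ i ≡ 0ℚ
  supported-balanced⇒zero basic z≡zOf {δ} supported balanced i = ≡.trans (≡.sym (window-in δ i (ℕ.≤-refl , t₀≤t₁)))
    (basic⇒direction≡0 I ε (window δ) basic z≡zOf ε≢0 (window-jumps {δ} {ε} admissible⁺)
      (window-feasible {δ} {ε} admissible⁺ balanced) (window-feasible {δ} { - ε} admissible⁻ balanced)
      t₀ i 1≤t₀ (ℕ.≤-trans t₀≤t₁ t₁≤T))
    where
    ε-admissible = nearZero-∀ (admissible-nearZero supported)
    ε = proj₁ ε-admissible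
    0<ε = proj₁ (proj₂ ε-admissible)
    ε≢0 : ε ≢ 0ℚ
    ε≢0 ε≡0 = QP.<-irrefl (≡.sym ε≡0) 0<ε
    ∣ε∣≡ε : ∣ ε ∣ ≡ ε
    ∣ε∣≡ε = QP.0≤p⇒∣p∣≡p (QP.<⇒≤ 0<ε)
    admissible⁺ = proj₂ (proj₂ ε-admissible) ε (QP.≤-reflexive ∣ε∣≡ε)
    admissible⁻ = proj₂ (proj₂ ε-admissible) (- ε) (QP.≤-reflexive (≡.trans (QP.∣-p∣≡∣p∣ ε) ∣ε∣≡ε))

  outsideF : List (Fin n)
  outsideF = filter (¬? ∘ InF? I x t₀ t₁) (allFin n)

  windowRows : List (Fin n → ℚ)
  windowRows = applyUpTo (λ k → w (t₀ ℕ.+ k)) (suc t₁ ∸ t₀)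

  -- the unit rows force δ to vanish outside F(t₀, t₁)
  equations : List (Fin n → ℚ)
  equations = windowRows ++ map unit outsideF

  wide⇒few-equations : suc t₁ ∸ t₀ < cardF I x t₀ t₁ → length equations < n
  wide⇒few-equations wide = subst₂ _<_
    (≡.sym (≡.trans (length-++ windowRows) (cong₂ ℕ._+_ (length-applyUpTo _ (suc t₁ ∸ t₀)) (length-map unit outsideF))))
    (≡.trans (length-filter+length-filter-¬ (InF? I x t₀ t₁) (allFin n)) (length-tabulate (λ i → i)))
    (ℕ.+-monoˡ-< (length outsideF) wide)

  wide-window⇒direction : suc t₁ ∸ t₀ < cardF I x t₀ t₁ →
    Σ (Fin n → ℚ) λ δ → (∃ λ i → δ i ≢ 0ℚ) × Supported δ × Balanced δ
  wide-window⇒direction wide with underdetermined⇒nonzero-solution n equations (wide⇒few-equations wide)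
  ... | δ , nonzero , equations⊥δ = δ , nonzero , supported , balanced
    where
    supported : Supported δ
    supported i δᵢ≢0 with InF? I x t₀ t₁ i
    ... | yes i∈F = i∈F
    ... | no  i∉F = contradiction (≡.trans (≡.sym (dot-unitˡ i δ)) (All.lookup equations⊥δ unit-row)) δᵢ≢0
      where
      unit-row = ∈-++⁺ʳ windowRows (∈-map⁺ unit (∈-filter⁺ (¬? ∘ InF? I x t₀ t₁) (∈-allFin i) i∉F))
    balanced : Balanced δ
    balanced t (t₀≤t , t≤t₁) = All.lookup equations⊥δ (∈-++⁺ˡ (subst (λ k → w k ∈ windowRows) (ℕ.m+[n∸m]≡n t₀≤t)
      (∈-applyUpTo⁺ (λ k → w (t₀ ℕ.+ k)) (ℕ.∸-monoˡ-< (s≤s t≤t₁) t₀≤t))))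

lemma2 : (I : Instance) (S : Point (Instance.n I)) →
         Basic I S →
         (∀ t i → 1 ≤ t → t < Instance.T I →
            Point.z S t i ≡ 1ℚ - ∣ Point.x S (suc t) i - Point.x S t i ∣) →
         (t₀ t₁ : ℕ) → 1 ≤ t₀ → t₀ ≤ t₁ → t₁ ≤ Instance.T I →
         cardF I (Point.x S) t₀ t₁ ≤ suc t₁ ∸ t₀
lemma2 I S basic z≡zOf t₀ t₁ 1≤t₀ t₀≤t₁ t₁≤T = ℕ.≮⇒≥ λ wide →
  let δ , (i , δᵢ≢0) , supported , balanced = wide-window⇒direction wide
  in  δᵢ≢0 (supported-balanced⇒zero basic z≡zOf supported balanced i)
  where open Window I S (proj₁ basic) t₀ t₁ 1≤t₀ t₀≤t₁ t₁≤T
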